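{- Let $m\ge1$ and let $\pi$ be a parity-alternating permutation of $[2m]$ avoiding both $231$ and $123$. Then $\pi=[t,t-1,\dots,1,2m,2m-1,\dots,t+1]$ for some odd $t\in[2m]$. Consequently $\mathrm{p}_{231,123}(2m)=m$.
   Context: A parity-alternating permutation (PAP) of $[n]$ is a permutation $\pi$ with $\pi(i)\equiv i\pmod 2$ for all $i$. A permutation contains a pattern $\sigma$ if some subsequence of its one-line notation is order-isomorphic to $\sigma$, and avoids it otherwise. $\mathrm{p}_{\sigma,\tau}(n)$ is the number of PAPs of $[n]$ avoiding both $\sigma$ and $\tau$. -}

module Defs where

open import Data.Nat using (ℕ; zero; suc; _+_; _*_; _∸_; _<_; _%_)
open import Data.Fin using (Fin; toℕ) renaming (_<_ to _<ᶠ_)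
open import Data.List using (List; []; _∷_; length; lookup; map; upTo; reverse; _++_)
open import Data.List.Relation.Binary.Permutation.Propositional using (_↭_)
open import Data.Product using (Σ; _×_)
open import Relation.Binary.PropositionalEquality using (_≡_)
open import Relation.Nullary using (¬_)
open import Function.Bundles using (_⇔_)

-- permutations of [n] = {1,…,n} in one-line notation, as lists of naturals

range1 : ℕ → List ℕ
range1 n = map suc (upTo n)

IsPerm : ℕ → List ℕ → Set
IsPerm n π = π ↭ range1 n

-- parity-alternating: π(i) ≡ i (mod 2) for every (1-based) position i
IsPAP : List ℕ → Set
IsPAP π = (i : Fin (length π)) → lookup π i % 2 ≡ suc (toℕ i) % 2

Contains : List ℕ → List ℕ → Set
Contains π σ =
  Σ (Fin (length σ) → Fin (length π)) λ f →
    ((i j : Fin (length σ)) → i <ᶠ j → f i <ᶠ f j) ×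
    ((i j : Fin (length σ)) → (lookup σ i < lookup σ j) ⇔ (lookup π (f i) < lookup π (f j)))

Avoids : List ℕ → List ℕ → Set
Avoids π σ = ¬ Contains π σ

PAPAvoiding : ℕ → List ℕ → List ℕ → List ℕ → Set
PAPAvoiding n σ τ π = IsPerm n π × IsPAP π × Avoids π σ × Avoids π τ

shape : ℕ → ℕ → List ℕ
shape n t = reverse (range1 t) ++ reverse (map (t +_) (range1 (n ∸ t)))

p231 : List ℕ
p231 = 2 ∷ 3 ∷ 1 ∷ []

p123 : List ℕ
p123 = 1 ∷ 2 ∷ 3 ∷ []

{-# OPTIONS --safe #-}
-- Let t be the number of entries of π before its maximum n = 2m. An ascent before n would
-- form 123 with n, and an entry before n larger than one after it would form 231 with n.
-- The first entry is odd and n even, so t > 0, and then an ascent after n would form 123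
-- with the first entry. Hence π decreases strictly before n and from n on, and everything
-- before n is smaller than everything after it. Along a strictly decreasing run the sum
-- value + position cannot increase; comparing the two ends of each run pins it, which gives
-- π = [t, …, 1, n, …, t+1] with t = π(1) odd. Conversely each such shape with t odd is a
-- PAP avoiding both patterns, one for each t ∈ {1, 3, …, 2m − 1}.
module Submission where

open import Defs
open import Data.Nat using (ℕ; zero; suc; _+_; _*_; _∸_; _≤_; _<_; _%_; _/_; z≤n; s≤s; z<s; s<s)
open import Data.Nat.Properties
open import Data.Fin using (Fin; toℕ; fromℕ<) renaming (zero to fz; suc to fs)
open import Data.Fin.Properties using (toℕ<n; toℕ-fromℕ<)
open import Data.List
  using (List; []; _∷_; length; lookup; map; upTo; reverse; _++_; applyUpTo; applyDownFrom)
open import Data.List.Properties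
  using ( length-map; length-upTo; length-applyUpTo; length-++; length-applyDownFrom
        ; map-∘; map-cong; map-upTo; reverse-applyUpTo)
open import Data.List.Membership.Propositional using (_∈_)
open import Data.List.Membership.Propositional.Properties
  using (∈-map⁺; ∈-map⁻; ∈-upTo⁺; ∈-upTo⁻; ∈-applyUpTo⁺; ∈-applyUpTo⁻)
open import Data.List.Relation.Binary.Permutation.Propositional
  using (_↭_; ↭-sym; ↭-trans; ↭-reflexive; ↭⇒↭ₛ)
open import Data.List.Relation.Binary.Permutation.Propositional.Properties
  using (∈-resp-↭; ↭-length; ++⁺; ↭-reverse)
import Data.List.Relation.Binary.Permutation.Setoid.Properties as ↭ₛ
open import Data.List.Relation.Unary.Any using (here; there)
open import Data.List.Relation.Unary.All using (All; _∷_)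
open import Data.List.Relation.Unary.AllPairs using (_∷_)
open import Data.List.Relation.Unary.Unique.Propositional using (Unique)
open import Data.List.Relation.Unary.Unique.Propositional.Properties using (upTo⁺; map⁺; applyUpTo⁺₁)
open import Data.Product using (Σ; ∃-syntax; _×_; _,_; proj₁; proj₂)
open import Data.Sum using (inj₁; inj₂)
open import Data.Empty using (⊥; ⊥-elim)
open import Function.Base using (_∘_; _∘₂_)
open import Function.Bundles using (_⇔_; mk⇔; Equivalence)
open import Relation.Nullary using (¬_; Dec; yes; no)
open import Relation.Binary.PropositionalEquality
open import Relation.Binary.Definitions using (tri<; tri≈; tri>)
open import Data.Nat.Tactic.RingSolver using (solve-∀)
open import Data.Nat.DivMod using (%-distribˡ-+; m*n%n≡0; [m+kn]%n≡m%n; m≡m%n+[m/n]*n)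

-- Lookup by a 0-based position, with junk value 0 past the end.
at : List ℕ → ℕ → ℕ
at []       _       = 0
at (x ∷ xs) zero    = x
at (x ∷ xs) (suc i) = at xs i

lookup≡at : ∀ xs (i : Fin (length xs)) → lookup xs i ≡ at xs (toℕ i)
lookup≡at (x ∷ xs) fz     = refl
lookup≡at (x ∷ xs) (fs i) = lookup≡at xs i

lookup-fromℕ< : ∀ xs {i} (i<∣xs∣ : i < length xs) → lookup xs (fromℕ< i<∣xs∣) ≡ at xs i
lookup-fromℕ< xs {i} i<∣xs∣ = trans (lookup≡at xs _) (cong (at xs) (toℕ-fromℕ< i<∣xs∣))

at-extensional : ∀ xs ys → length xs ≡ length ys →
                 (∀ i → i < length xs → at xs i ≡ at ys i) → xs ≡ ys
at-extensional []       []       _  _  = refl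
at-extensional (x ∷ xs) (y ∷ ys) eq pw =
  cong₂ _∷_ (pw 0 z<s) (at-extensional xs ys (suc-injective eq) (λ i → pw (suc i) ∘ s<s))

at-∈ : ∀ xs {i} → i < length xs → at xs i ∈ xs
at-∈ (x ∷ xs) {zero}  _         = here refl
at-∈ (x ∷ xs) {suc i} (s≤s i<) = there (at-∈ xs i<)

∈⇒at : ∀ {x} xs → x ∈ xs → ∃[ i ] i < length xs × at xs i ≡ x
∈⇒at (y ∷ xs) (here refl) = 0 , z<s , refl
∈⇒at (y ∷ xs) (there x∈) with i , i< , eq ← ∈⇒at xs x∈ = suc i , s<s i< , eq

All⇒at : ∀ {P : ℕ → Set} xs → All P xs → ∀ {i} → i < length xs → P (at xs i)
All⇒at (x ∷ xs) (px ∷ _)  {zero}  _        = px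
All⇒at (x ∷ xs) (_ ∷ pxs) {suc i} (s≤s i<) = All⇒at xs pxs i<

Unique⇒at-distinct : ∀ xs → Unique xs → ∀ {i j} → i < j → j < length xs → at xs i ≢ at xs j
Unique⇒at-distinct (x ∷ xs) (x∉ ∷ _) {zero}  {suc j} _         (s≤s j<) = All⇒at xs x∉ j<
Unique⇒at-distinct (x ∷ xs) (_ ∷ u)  {suc i} {suc j} (s≤s i<j) (s≤s j<) = Unique⇒at-distinct xs u i<j j<

Unique⇒at-injective : ∀ xs → Unique xs → ∀ {i j} → i < length xs → j < length xs →
                      at xs i ≡ at xs j → i ≡ j
Unique⇒at-injective xs u {i} {j} i< j< eq with <-cmp i j
... | tri< i<j _ _ = ⊥-elim (Unique⇒at-distinct xs u i<j j< eq)
... | tri≈ _ i≡j _ = i≡j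
... | tri> _ _ j<i = ⊥-elim (Unique⇒at-distinct xs u j<i i< (sym eq))

at-++ˡ : ∀ xs ys {i} → i < length xs → at (xs ++ ys) i ≡ at xs i
at-++ˡ (x ∷ xs) ys {zero}  _        = refl
at-++ˡ (x ∷ xs) ys {suc i} (s≤s i<) = at-++ˡ xs ys i<

at-++ʳ : ∀ xs ys {m} i → length xs ≡ m → at (xs ++ ys) (m + i) ≡ at ys i
at-++ʳ []       ys i refl = refl
at-++ʳ (x ∷ xs) ys i refl = at-++ʳ xs ys i refl

at-applyDownFrom : ∀ (f : ℕ → ℕ) i j → at (applyDownFrom f (suc (i + j))) i ≡ f j
at-applyDownFrom f zero    j = refl
at-applyDownFrom f (suc i) j = at-applyDownFrom f i j

suc-of-odd-is-even : ∀ i → i % 2 ≡ 1 → suc i % 2 ≡ 0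
suc-of-odd-is-even (suc zero)    _ = refl
suc-of-odd-is-even (suc (suc i)) h = suc-of-odd-is-even i h

odd-sum-parity : ∀ x i → (x + i) % 2 ≡ 1 → x % 2 ≡ suc i % 2
odd-sum-parity zero          i h = sym (suc-of-odd-is-even i h)
odd-sum-parity (suc zero)    i h = sym h
odd-sum-parity (suc (suc x)) i h = odd-sum-parity x i h

odd+even-is-odd : ∀ a b → a % 2 ≡ 1 → b % 2 ≡ 0 → (a + b) % 2 ≡ 1
odd+even-is-odd a b a-odd b-even = begin
  (a + b) % 2              ≡⟨ %-distribˡ-+ a b 2 ⟩
  (a % 2 + b % 2) % 2      ≡⟨ cong₂ (λ u v → (u + v) % 2) a-odd b-even ⟩
  1                        ∎
  where open ≡-Reasoning

even-double : ∀ m → (2 * m) % 2 ≡ 0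
even-double m = trans (cong (_% 2) (*-comm 2 m)) (m*n%n≡0 m 2)

odd-double-suc : ∀ r → suc (2 * r) % 2 ≡ 1
odd-double-suc r = trans (cong (λ x → suc x % 2) (*-comm 2 r)) ([m+kn]%n≡m%n 1 r 2)

odd≡1+2*half : ∀ t → t % 2 ≡ 1 → t ≡ suc (2 * (t / 2))
odd≡1+2*half t t-odd = begin
  t                      ≡⟨ m≡m%n+[m/n]*n t 2 ⟩
  t % 2 + (t / 2) * 2    ≡⟨ cong₂ _+_ t-odd (*-comm (t / 2) 2) ⟩
  suc (2 * (t / 2))      ∎
  where open ≡-Reasoning

double-positive : ∀ {m} → 1 ≤ m → 0 < 2 * m
double-positive 1≤m = <-≤-trans z<s (*-monoʳ-≤ 2 1≤m)

IsPAP⇒at-parity : ∀ π → IsPAP π → ∀ {i} → i < length π → at π i % 2 ≡ suc i % 2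
IsPAP⇒at-parity π pap i<∣π∣ = subst₂ (λ u v → u % 2 ≡ suc v % 2)
  (lookup-fromℕ< π i<∣π∣) (toℕ-fromℕ< i<∣π∣) (pap (fromℕ< i<∣π∣))

SameOrder : ℕ → ℕ → ℕ → ℕ → Set
SameOrder x y u v = (x < y ⇔ u < v) × (y < x ⇔ v < u)

sameOrder-< : ∀ {x y u v} → x < y → u < v → SameOrder x y u v
sameOrder-< x<y u<v = mk⇔ (λ _ → u<v) (λ _ → x<y)
                    , mk⇔ (⊥-elim ∘ <-asym x<y) (⊥-elim ∘ <-asym u<v)

sameOrder-> : ∀ {x y u v} → y < x → v < u → SameOrder x y u v
sameOrder-> y<x v<u = proj₂ (sameOrder-< y<x v<u) , proj₁ (sameOrder-< y<x v<u)

record Occurrence (π : List ℕ) (x y z : ℕ) : Set where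
  field
    a b c  : ℕ
    a<b    : a < b
    b<c    : b < c
    c<∣π∣  : c < length π
    ab     : SameOrder x y (at π a) (at π b)
    ac     : SameOrder x z (at π a) (at π c)
    bc     : SameOrder y z (at π b) (at π c)

contains⇔occurrence : ∀ π x y z → Contains π (x ∷ y ∷ z ∷ []) ⇔ Occurrence π x y z
contains⇔occurrence π x y z = mk⇔ occurrence contains
  where
  σ = x ∷ y ∷ z ∷ []

  occurrence : Contains π σ → Occurrence π x y z
  occurrence (f , mono , iso) = record
    { a = pos fz ; b = pos (fs fz) ; c = pos (fs (fs fz))
    ; a<b = mono fz (fs fz) (s≤s z≤n)
    ; b<c = mono (fs fz) (fs (fs fz)) (s≤s (s≤s z≤n))
    ; c<∣π∣ = toℕ<n (f (fs (fs fz)))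
    ; ab = order fz (fs fz) ; ac = order fz (fs (fs fz)) ; bc = order (fs fz) (fs (fs fz))
    }
    where
    pos : Fin 3 → ℕ
    pos k = toℕ (f k)

    order : ∀ i j → SameOrder (lookup σ i) (lookup σ j) (at π (pos i)) (at π (pos j))
    order i j = transport (iso i j) , transport (iso j i)
      where
      transport : ∀ {k l} → (lookup σ k < lookup σ l) ⇔ (lookup π (f k) < lookup π (f l)) →
                  (lookup σ k < lookup σ l) ⇔ (at π (pos k) < at π (pos l))
      transport {k} {l} = subst₂ (λ u v → _ ⇔ u < v) (lookup≡at π (f k)) (lookup≡at π (f l))

  contains : Occurrence π x y z → Contains π σ
  contains occ = f , mono , iso
    where
    open Occurrence occ

    pos : Fin 3 → ℕ
    pos fz           = a
    pos (fs fz)      = b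
    pos (fs (fs fz)) = c

    pos<∣π∣ : ∀ k → pos k < length π
    pos<∣π∣ fz           = <-trans a<b (<-trans b<c c<∣π∣)
    pos<∣π∣ (fs fz)      = <-trans b<c c<∣π∣
    pos<∣π∣ (fs (fs fz)) = c<∣π∣

    f : Fin 3 → Fin (length π)
    f k = fromℕ< (pos<∣π∣ k)

    pos-mono : ∀ i j → toℕ i < toℕ j → pos i < pos j
    pos-mono fz           (fs fz)      _ = a<b
    pos-mono fz           (fs (fs fz)) _ = <-trans a<b b<c
    pos-mono (fs fz)      (fs (fs fz)) _ = b<c
    pos-mono fz           fz           ()
    pos-mono (fs fz)      fz           ()
    pos-mono (fs fz)      (fs fz)      (s≤s ())
    pos-mono (fs (fs fz)) fz           ()
    pos-mono (fs (fs fz)) (fs fz)      (s≤s ())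
    pos-mono (fs (fs fz)) (fs (fs fz)) (s≤s (s≤s ()))

    mono : ∀ i j → toℕ i < toℕ j → toℕ (f i) < toℕ (f j)
    mono i j i<j = subst₂ _<_ (sym (toℕ-fromℕ< (pos<∣π∣ i))) (sym (toℕ-fromℕ< (pos<∣π∣ j)))
                          (pos-mono i j i<j)

    irrefl⇔ : ∀ {u v} → (u < u) ⇔ (v < v)
    irrefl⇔ = mk⇔ (⊥-elim ∘ <-irrefl refl) (⊥-elim ∘ <-irrefl refl)

    order : ∀ i j → (lookup σ i < lookup σ j) ⇔ (at π (pos i) < at π (pos j))
    order fz           fz           = irrefl⇔
    order fz           (fs fz)      = proj₁ ab
    order fz           (fs (fs fz)) = proj₁ ac
    order (fs fz)      fz           = proj₂ ab
    order (fs fz)      (fs fz)      = irrefl⇔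
    order (fs fz)      (fs (fs fz)) = proj₁ bc
    order (fs (fs fz)) fz           = proj₂ ac
    order (fs (fs fz)) (fs fz)      = proj₂ bc
    order (fs (fs fz)) (fs (fs fz)) = irrefl⇔

    iso : ∀ i j → (lookup σ i < lookup σ j) ⇔ (lookup π (f i) < lookup π (f j))
    iso i j = subst₂ (λ u v → _ ⇔ u < v) (sym (lookup-fromℕ< π (pos<∣π∣ i)))
                     (sym (lookup-fromℕ< π (pos<∣π∣ j))) (order i j)

contains123 : ∀ π {a b c} → a < b → b < c → c < length π →
              at π a < at π b → at π b < at π c → Contains π p123
contains123 π {a} {b} {c} a<b b<c c<∣π∣ ab bc = Equivalence.from (contains⇔occurrence π 1 2 3) record
  { a = a ; b = b ; c = c ; a<b = a<b ; b<c = b<c ; c<∣π∣ = c<∣π∣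
  ; ab = sameOrder-< (s≤s (s≤s z≤n)) ab
  ; ac = sameOrder-< (s≤s (s≤s z≤n)) (<-trans ab bc)
  ; bc = sameOrder-< (s≤s (s≤s (s≤s z≤n))) bc
  }

contains231 : ∀ π {a b c} → a < b → b < c → c < length π →
              at π c < at π a → at π a < at π b → Contains π p231
contains231 π {a} {b} {c} a<b b<c c<∣π∣ ca ab = Equivalence.from (contains⇔occurrence π 2 3 1) record
  { a = a ; b = b ; c = c ; a<b = a<b ; b<c = b<c ; c<∣π∣ = c<∣π∣
  ; ab = sameOrder-< (s≤s (s≤s (s≤s z≤n))) ab
  ; ac = sameOrder-> (s≤s (s≤s z≤n)) ca
  ; bc = sameOrder-> (s≤s (s≤s z≤n)) (<-trans ca ab)
  }

length-range1 : ∀ n → length (range1 n) ≡ n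
length-range1 n = trans (length-map suc (upTo n)) (length-upTo n)

∈-range1⁺ : ∀ {x n} → x < n → suc x ∈ range1 n
∈-range1⁺ x<n = ∈-map⁺ suc (∈-upTo⁺ x<n)

∈-range1⁻ : ∀ {x n} → x ∈ range1 n → 1 ≤ x × x ≤ n
∈-range1⁻ x∈ with _ , y∈ , refl ← ∈-map⁻ suc x∈ = s≤s z≤n , ∈-upTo⁻ y∈

range1-unique : ∀ n → Unique (range1 n)
range1-unique n = map⁺ suc-injective (upTo⁺ n)

module _ {n π} (π↭ : IsPerm n π) where

  perm-length : length π ≡ n
  perm-length = trans (↭-length π↭) (length-range1 n)

  perm-bounded : ∀ {i} → i < n → 1 ≤ at π i × at π i ≤ n
  perm-bounded i<n = ∈-range1⁻ (∈-resp-↭ π↭ (at-∈ π (subst (_ <_) (sym perm-length) i<n)))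

  perm-injective : ∀ {i j} → i < n → j < n → at π i ≡ at π j → i ≡ j
  perm-injective i<n j<n = Unique⇒at-injective π unique (<-length i<n) (<-length j<n)
    where
    unique : Unique π
    unique = ↭ₛ.Unique-resp-↭ (setoid ℕ) (↭⇒↭ₛ (↭-sym π↭)) (range1-unique n)
    <-length : ∀ {i} → i < n → i < length π
    <-length = subst (_ <_) (sym perm-length)

  perm-position : ∀ {x} → x < n → ∃[ i ] i < n × at π i ≡ suc x
  perm-position x<n with i , i< , eq ← ∈⇒at π (∈-resp-↭ (↭-sym π↭) (∈-range1⁺ x<n)) =
    i , subst (i <_) perm-length i< , eq

applyUpTo-++ : ∀ (f : ℕ → ℕ) m k → applyUpTo f (m + k) ≡ applyUpTo f m ++ applyUpTo (f ∘ (m +_)) k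
applyUpTo-++ f zero    k = refl
applyUpTo-++ f (suc m) k = cong (f 0 ∷_) (applyUpTo-++ (f ∘ suc) m k)

range1-++ : ∀ t k → range1 t ++ map (t +_) (range1 k) ≡ range1 (t + k)
range1-++ t k = begin
  range1 t ++ map (t +_) (range1 k)              ≡⟨ cong (range1 t ++_) (sym (map-∘ (upTo k))) ⟩
  range1 t ++ map ((t +_) ∘ suc) (upTo k)        ≡⟨ cong (range1 t ++_) (map-cong (+-suc t) (upTo k)) ⟩
  range1 t ++ map (suc ∘ (t +_)) (upTo k)        ≡⟨ cong₂ _++_ (map-upTo suc t) (map-upTo _ k) ⟩
  applyUpTo suc t ++ applyUpTo (suc ∘ (t +_)) k  ≡⟨ applyUpTo-++ suc t k ⟨
  applyUpTo suc (t + k)                          ≡⟨ map-upTo suc (t + k) ⟨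
  range1 (t + k)                                 ∎
  where open ≡-Reasoning

DecreasingOn : (ℕ → ℕ) → ℕ → ℕ → Set
DecreasingOn g a l = ∀ i → a ≤ i → i < l → g (suc i) < g i

module _ {g : ℕ → ℕ} {a l : ℕ} (dec : DecreasingOn g a l) where

  decreasing⇒sum-antitone : ∀ {i j} → a ≤ i → i ≤ j → j ≤ l → g j + j ≤ g i + i
  decreasing⇒sum-antitone {i} {j} a≤i i≤j j≤l with m≤n⇒m<n∨m≡n i≤j
  ... | inj₂ refl = ≤-refl
  ... | inj₁ (s≤s {n = k} i≤k) = begin
    g (suc k) + suc k  ≡⟨ +-suc (g (suc k)) k ⟩
    suc (g (suc k) + k) ≤⟨ +-monoˡ-≤ k (dec k (≤-trans a≤i i≤k) j≤l) ⟩
    g k + k            ≤⟨ decreasing⇒sum-antitone a≤i i≤k (<⇒≤ j≤l) ⟩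
    g i + i            ∎
    where open ≤-Reasoning

  decreasing-pinned : ∀ {c} → g a + a ≤ c → c ≤ g l + l → ∀ {i} → a ≤ i → i ≤ l → g i + i ≡ c
  decreasing-pinned upper lower a≤i i≤l = ≤-antisym
    (≤-trans (decreasing⇒sum-antitone ≤-refl a≤i i≤l) upper)
    (≤-trans lower (decreasing⇒sum-antitone a≤i i≤l ≤-refl))

-- Positions are 0-based; n = 1 + l, and the maximum of g sits at position p = 1 + q.
module MaximumSplit
  (g : ℕ → ℕ) (q l : ℕ)
  (bounded   : ∀ {i} → i < suc l → 1 ≤ g i × g i ≤ suc l)
  (injective : ∀ {i j} → i < suc l → j < suc l → g i ≡ g j → i ≡ j)
  (no123     : ∀ {a b c} → a < b → b < c → c < suc l → g a < g b → g b < g c → ⊥)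
  (no231     : ∀ {a b c} → a < b → b < c → c < suc l → g c < g a → g a < g b → ⊥)
  (q<l       : q < l)
  (g[1+q]≡n  : g (suc q) ≡ suc l)
  where

  p n : ℕ
  p = suc q
  n = suc l

  p<n : p < n
  p<n = s<s q<l

  no-ascent⇒descent : ∀ {i j} → i ≢ j → i < n → j < n → ¬ (g i < g j) → g j < g i
  no-ascent⇒descent i≢j i<n j<n ¬asc =
    ≤∧≢⇒< (≮⇒≥ ¬asc) (λ eq → i≢j (injective i<n j<n (sym eq)))

  below-max : ∀ {i} → i < n → i ≢ p → g i < g p
  below-max {i} i<n i≢p = ≤∧≢⇒< (subst (g i ≤_) (sym g[1+q]≡n) (proj₂ (bounded i<n)))
                                 (i≢p ∘ injective i<n p<n)

  decreasing-before : DecreasingOn g 0 q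
  decreasing-before i _ i<q = no-ascent⇒descent (<⇒≢ (n<1+n i)) i<n (<-trans (s<s i<q) p<n)
    (λ asc → no123 (n<1+n i) (s<s i<q) p<n asc (below-max (<-trans (s<s i<q) p<n) (<⇒≢ (s<s i<q))))
    where
    i<n : i < n
    i<n = <-trans (<-trans (n<1+n i) (s<s i<q)) p<n

  before<after : ∀ {i j} → i < p → p < j → j < n → g i < g j
  before<after i<p p<j j<n = no-ascent⇒descent (≢-sym (<⇒≢ i<j)) j<n (<-trans i<j j<n)
    (λ desc → no231 i<p p<j j<n desc (below-max (<-trans i<p p<n) (<⇒≢ i<p)))
    where
    i<j = <-trans i<p p<j

  decreasing-after : DecreasingOn g p l
  decreasing-after i p≤i i<l with m≤n⇒m<n∨m≡n p≤i
  ... | inj₂ refl = below-max (s<s i<l) 1+n≢n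
  ... | inj₁ p<i = no-ascent⇒descent (<⇒≢ (n<1+n i)) (<-trans i<l (n<1+n l)) (s<s i<l)
    (λ asc → no123 (<-trans z<s p<i) (n<1+n i) (s<s i<l) (before<after z<s p<i (<-trans i<l (n<1+n l))) asc)

  first<last : g 0 < g l
  first<last with m≤n⇒m<n∨m≡n q<l
  ... | inj₁ p<l = before<after z<s p<l (n<1+n l)
  ... | inj₂ refl = below-max z<s 0≢1+n

  last≤2+q : g l ≤ suc p
  last≤2+q = +-cancelʳ-≤ l (g l) (suc p) (begin
    g l + l   ≤⟨ decreasing⇒sum-antitone decreasing-after ≤-refl q<l ≤-refl ⟩
    g p + p   ≡⟨ cong (_+ p) g[1+q]≡n ⟩
    n + p     ≡⟨ +-comm n p ⟩
    p + n     ≡⟨ +-suc p l ⟩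
    suc p + l ∎)
    where open ≤-Reasoning

  first-block : ∀ {i} → i ≤ q → g i + i ≡ p
  first-block = decreasing-pinned decreasing-before upper lower z≤n
    where
    upper : g 0 + 0 ≤ p
    upper = subst (_≤ p) (sym (+-identityʳ (g 0))) (≤-pred (<-≤-trans first<last last≤2+q))
    lower : p ≤ g q + q
    lower = +-monoˡ-≤ q (proj₁ (bounded (<-trans (n<1+n q) p<n)))

  second-block : ∀ {i} → p ≤ i → i ≤ l → g i + i ≡ p + n
  second-block = decreasing-pinned decreasing-after upper lower
    where
    upper : g p + p ≤ p + n
    upper = ≤-reflexive (trans (cong (_+ p) g[1+q]≡n) (+-comm n p))
    g0≡p : g 0 ≡ p
    g0≡p = trans (sym (+-identityʳ (g 0))) (first-block z≤n)
    lower : p + n ≤ g l + l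
    lower = subst (_≤ g l + l) (sym (+-suc p l)) (+-monoˡ-≤ l (subst (_< g l) g0≡p first<last))

blocks : ℕ → ℕ → List ℕ
blocks t k = applyDownFrom suc t ++ applyDownFrom (λ j → t + suc j) k

shape≡blocks : ∀ n t → shape n t ≡ blocks t (n ∸ t)
shape≡blocks n t = cong₂ _++_
  (trans (cong reverse (map-upTo suc t)) (reverse-applyUpTo suc t))
  (trans (cong reverse (trans (sym (map-∘ (upTo (n ∸ t)))) (map-upTo _ (n ∸ t))))
         (reverse-applyUpTo _ (n ∸ t)))

module _ {n t : ℕ} (t≤n : t ≤ n) where

  shape-length : length (shape n t) ≡ n
  shape-length = begin
    length (shape n t)          ≡⟨ cong length (shape≡blocks n t) ⟩
    length (blocks t (n ∸ t))   ≡⟨ length-++ (applyDownFrom suc t) ⟩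
    _                           ≡⟨ cong₂ _+_ (length-applyDownFrom suc t) (length-applyDownFrom _ (n ∸ t)) ⟩
    t + (n ∸ t)                 ≡⟨ m+[n∸m]≡n t≤n ⟩
    n                           ∎
    where open ≡-Reasoning

  shape-↭ : IsPerm n (shape n t)
  shape-↭ = ↭-trans (++⁺ (↭-reverse (range1 t)) (↭-reverse (map (t +_) (range1 (n ∸ t)))))
                    (↭-reflexive (trans (range1-++ t (n ∸ t)) (cong range1 (m+[n∸m]≡n t≤n))))

at-shape-first : ∀ n {t i} → i < t → at (shape n t) i + i ≡ t
at-shape-first n {i = i} i<t with j , refl ← m≤n⇒∃[o]m+o≡n i<t = begin
  at (shape n (suc i + j)) i + i       ≡⟨ cong (λ xs → at xs i + i) (shape≡blocks n (suc i + j)) ⟩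
  at (blocks (suc i + j) _) i + i      ≡⟨ cong (_+ i) (at-++ˡ (applyDownFrom suc (suc i + j)) _ i<t′) ⟩
  at (applyDownFrom suc (suc i + j)) i + i ≡⟨ cong (_+ i) (at-applyDownFrom suc i j) ⟩
  suc j + i                            ≡⟨ cong suc (+-comm j i) ⟩
  suc i + j                            ∎
  where
  open ≡-Reasoning
  i<t′ : i < length (applyDownFrom suc (suc i + j))
  i<t′ = subst (i <_) (sym (length-applyDownFrom suc (suc i + j))) i<t

at-shape-second : ∀ {n t i} → t ≤ i → i < n → at (shape n t) i + i ≡ t + n
at-shape-second {t = t} t≤i i<n
  with k , refl ← m≤n⇒∃[o]m+o≡n t≤i | j , refl ← m≤n⇒∃[o]m+o≡n i<n = begin
  at (shape n t) (t + k) + (t + k)         ≡⟨ cong (λ xs → at xs (t + k) + (t + k)) (shape≡blocks n t) ⟩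
  at (blocks t (n ∸ t)) (t + k) + (t + k)  ≡⟨ cong (_+ (t + k)) (at-++ʳ (applyDownFrom suc t) _ k
                                                                          (length-applyDownFrom suc t)) ⟩
  at (second (n ∸ t)) k + (t + k)          ≡⟨ cong (λ m → at (second m) k + (t + k)) n∸t≡1+k+j ⟩
  at (second (suc (k + j))) k + (t + k)    ≡⟨ cong (_+ (t + k)) (at-applyDownFrom _ k j) ⟩
  t + suc j + (t + k)                      ≡⟨ rearrange t k j ⟩
  t + n                                    ∎
  where
  open ≡-Reasoning
  n = suc (t + k) + j
  second : ℕ → List ℕ
  second = applyDownFrom (λ j → t + suc j)
  rearrange : ∀ t k j → t + suc j + (t + k) ≡ t + (suc (t + k) + j)
  rearrange = solve-∀
  n∸t≡1+k+j : n ∸ t ≡ suc (k + j)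
  n∸t≡1+k+j = trans (cong (_∸ t) (trans (cong suc (+-assoc t k j)) (sym (+-suc t (k + j)))))
                    (m+n∸m≡n t (suc (k + j)))

shape-head : ∀ n {t} → 0 < t → at (shape n t) 0 ≡ t
shape-head n 0<t = trans (sym (+-identityʳ _)) (at-shape-first n 0<t)

equal-sums-descend : ∀ {x y i j} → x + i ≡ y + j → i < j → y < x
equal-sums-descend {x} {y} {i} {j} eq i<j = +-cancelʳ-< j y x (subst (_< x + j) eq (+-monoʳ-< x i<j))

module TwoDescendingBlocks
  (V : ℕ → ℕ) {t n : ℕ}
  (first  : ∀ {i} → i < t → V i + i ≡ t)
  (second : ∀ {i} → t ≤ i → i < n → V i + i ≡ t + n)
  where

  ascent⇒straddles : ∀ {i j} → i < j → j < n → V i < V j → i < t × t ≤ j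
  ascent⇒straddles {i} {j} i<j j<n asc with i <? t | t ≤? j
  ... | yes i<t | yes t≤j = i<t , t≤j
  ... | yes i<t | no  t≰j = ⊥-elim (<-asym asc
          (equal-sums-descend (trans (first i<t) (sym (first (≰⇒> t≰j)))) i<j))
  ... | no  i≮t | _       = ⊥-elim (<-asym asc
          (equal-sums-descend (trans (second t≤i (<-trans i<j j<n)) (sym (second t≤j j<n))) i<j))
    where
    t≤i : t ≤ i
    t≤i = ≮⇒≥ i≮t
    t≤j : t ≤ j
    t≤j = ≤-trans t≤i (<⇒≤ i<j)

  straddle⇒ascent : ∀ {i j} → i < t → t ≤ j → j < n → V i < V j
  straddle⇒ascent {i} {j} i<t t≤j j<n = ≤-<-trans Vi≤t t<Vj
    where
    Vi≤t : V i ≤ t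
    Vi≤t = subst (V i ≤_) (first i<t) (m≤m+n (V i) i)
    t<Vj : t < V j
    t<Vj = +-cancelʳ-< j t (V j) (subst (t + j <_) (sym (second t≤j j<n)) (+-monoʳ-< t j<n))

module _ {n t : ℕ} (t≤n : t ≤ n) where

  private
    π = shape n t
    open TwoDescendingBlocks (at π) (at-shape-first n {t}) (at-shape-second {n} {t})

    <length⇒<n : ∀ {i} → i < length π → i < n
    <length⇒<n = subst (_ <_) (shape-length t≤n)

  shape-avoids123 : Avoids (shape n t) p123
  shape-avoids123 contains = <-irrefl refl (<-≤-trans b<t t≤b)
    where
    open Occurrence (Equivalence.to (contains⇔occurrence π 1 2 3) contains)
    c<n = <length⇒<n c<∣π∣
    t≤b = proj₂ (ascent⇒straddles a<b (<-trans b<c c<n) (Equivalence.to (proj₁ ab) (s≤s (s≤s z≤n))))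
    b<t = proj₁ (ascent⇒straddles b<c c<n (Equivalence.to (proj₁ bc) (s≤s (s≤s (s≤s z≤n)))))

  shape-avoids231 : Avoids (shape n t) p231
  shape-avoids231 contains = <-asym (straddle⇒ascent a<t (≤-trans t≤b (<⇒≤ b<c)) c<n) c<a
    where
    open Occurrence (Equivalence.to (contains⇔occurrence π 2 3 1) contains)
    c<n = <length⇒<n c<∣π∣
    a<t×t≤b = ascent⇒straddles a<b (<-trans b<c c<n) (Equivalence.to (proj₁ ab) (s≤s (s≤s (s≤s z≤n))))
    a<t = proj₁ a<t×t≤b
    t≤b = proj₂ a<t×t≤b
    c<a = Equivalence.to (proj₂ ac) (s≤s (s≤s z≤n))

shape-IsPAP : ∀ {n t} → t ≤ n → t % 2 ≡ 1 → n % 2 ≡ 0 → IsPAP (shape n t)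
shape-IsPAP {n} {t} t≤n t-odd n-even X = begin
  lookup (shape n t) X % 2  ≡⟨ cong (_% 2) (lookup≡at (shape n t) X) ⟩
  at (shape n t) i % 2      ≡⟨ odd-sum-parity (at (shape n t) i) i (value+position-odd (i <? t)) ⟩
  suc i % 2                 ∎
  where
  open ≡-Reasoning
  i = toℕ X
  i<n : i < n
  i<n = subst (i <_) (shape-length t≤n) (toℕ<n X)
  value+position-odd : Dec (i < t) → (at (shape n t) i + i) % 2 ≡ 1
  value+position-odd (yes i<t) = trans (cong (_% 2) (at-shape-first n i<t)) t-odd
  value+position-odd (no  i≮t) = trans (cong (_% 2) (at-shape-second (≮⇒≥ i≮t) i<n))
                                       (odd+even-is-odd t n t-odd n-even)

shape-PAPAvoiding : ∀ {n t} → t ≤ n → t % 2 ≡ 1 → n % 2 ≡ 0 → PAPAvoiding n p231 p123 (shape n t)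
shape-PAPAvoiding t≤n t-odd n-even =
  shape-↭ t≤n , shape-IsPAP t≤n t-odd n-even , shape-avoids231 t≤n , shape-avoids123 t≤n

PAPAvoiding⇒shape : ∀ {n π} → 0 < n → n % 2 ≡ 0 → PAPAvoiding n p231 p123 π →
                    ∃[ t ] t % 2 ≡ 1 × t ≤ n × π ≡ shape n t
PAPAvoiding⇒shape {suc l} {π} _ n-even (π↭ , pap , avoids231 , avoids123) =
  split-at-max (perm-position π↭ (n<1+n l))
  where
  n = suc l

  <n⇒<length : ∀ {i} → i < n → i < length π
  <n⇒<length = subst (_ <_) (sym (perm-length π↭))

  first-odd : at π 0 % 2 ≡ 1
  first-odd = IsPAP⇒at-parity π pap (<n⇒<length z<s)

  split-at-max : ∃[ p ] p < n × at π p ≡ n → ∃[ t ] t % 2 ≡ 1 × t ≤ n × π ≡ shape n t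
  split-at-max (zero , _ , π₀≡n) =
    ⊥-elim (0≢1+n (trans (sym n-even) (trans (cong (_% 2) (sym π₀≡n)) first-odd)))
  split-at-max (suc q , p<n , πp≡n) = p , p-odd , <⇒≤ p<n , π≡shape
    where
    p = suc q
    open MaximumSplit (at π) q l (perm-bounded π↭) (perm-injective π↭)
      (λ a<b b<c c<n → avoids123 ∘₂ contains123 π a<b b<c (<n⇒<length c<n))
      (λ a<b b<c c<n → avoids231 ∘₂ contains231 π a<b b<c (<n⇒<length c<n))
      (≤-pred p<n) πp≡n
      using (first-block; second-block)

    p-odd : p % 2 ≡ 1
    p-odd = trans (cong (_% 2) (trans (sym (first-block z≤n)) (+-identityʳ (at π 0)))) first-odd

    sums-agree : ∀ {i} → i < n → at π i + i ≡ at (shape n p) i + i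
    sums-agree {i} i<n with i <? p
    ... | yes i<p = trans (first-block (≤-pred i<p)) (sym (at-shape-first n i<p))
    ... | no  i≮p = trans (second-block (≮⇒≥ i≮p) (≤-pred i<n))
                          (sym (at-shape-second (≮⇒≥ i≮p) i<n))

    π≡shape : π ≡ shape n p
    π≡shape = at-extensional π (shape n p) (trans (perm-length π↭) (sym (shape-length (<⇒≤ p<n))))
      (λ i i<∣π∣ → +-cancelʳ-≡ i _ _ (sums-agree (subst (i <_) (perm-length π↭) i<∣π∣)))

odd-shapes : ℕ → ℕ → List (List ℕ)
odd-shapes n m = applyUpTo (λ r → shape n (suc (2 * r))) m

odd-shapes-unique : ∀ n m → Unique (odd-shapes n m)
odd-shapes-unique n m = applyUpTo⁺₁ _ m λ {r} {s} r<s _ eq →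
  <⇒≢ r<s (*-cancelˡ-≡ r s 2 (suc-injective (begin
    suc (2 * r)                   ≡⟨ shape-head n z<s ⟨
    at (shape n (suc (2 * r))) 0  ≡⟨ cong (λ π → at π 0) eq ⟩
    at (shape n (suc (2 * s))) 0  ≡⟨ shape-head n z<s ⟩
    suc (2 * s)                   ∎)))
  where open ≡-Reasoning

odd-shapes-complete : ∀ {m} → 1 ≤ m → ∀ π →
                      π ∈ odd-shapes (2 * m) m ⇔ PAPAvoiding (2 * m) p231 p123 π
odd-shapes-complete {m} 1≤m π = mk⇔ member⇒PAPAvoiding PAPAvoiding⇒member
  where
  member⇒PAPAvoiding : π ∈ odd-shapes (2 * m) m → PAPAvoiding (2 * m) p231 p123 π
  member⇒PAPAvoiding π∈ with r , r<m , refl ← ∈-applyUpTo⁻ _ π∈ =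
    shape-PAPAvoiding t≤2m (odd-double-suc r) (even-double m)
    where
    t≤2m : suc (2 * r) ≤ 2 * m
    t≤2m = ≤-trans (n≤1+n _) (subst (_≤ 2 * m) (*-suc 2 r) (*-monoʳ-≤ 2 r<m))

  PAPAvoiding⇒member : PAPAvoiding (2 * m) p231 p123 π → π ∈ odd-shapes (2 * m) m
  PAPAvoiding⇒member pa
    with t , t-odd , t≤2m , refl ← PAPAvoiding⇒shape (double-positive 1≤m) (even-double m) pa =
    subst (λ t → shape (2 * m) t ∈ odd-shapes (2 * m) m) (sym t≡1+2r)
          (∈-applyUpTo⁺ _ (*-cancelˡ-< 2 (t / 2) m (subst (_≤ 2 * m) t≡1+2r t≤2m)))
    where
    t≡1+2r : t ≡ suc (2 * (t / 2))
    t≡1+2r = odd≡1+2*half t t-odd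

mainTheorem19 : ((m : ℕ) → 1 ≤ m → (π : List ℕ) → PAPAvoiding (2 * m) p231 p123 π →
                  Σ ℕ λ t → (t % 2 ≡ 1) × (t ≤ 2 * m) × (π ≡ shape (2 * m) t))
                × ((m : ℕ) → 1 ≤ m →
                  Σ (List (List ℕ)) λ L → (length L ≡ m) × Unique L ×
                    ((π : List ℕ) → (π ∈ L) ⇔ PAPAvoiding (2 * m) p231 p123 π))
mainTheorem19 =
  (λ m 1≤m π → PAPAvoiding⇒shape (double-positive 1≤m) (even-double m))
  , λ m 1≤m → odd-shapes (2 * m) m , length-applyUpTo _ m , odd-shapes-unique (2 * m) m
            , odd-shapes-complete 1≤m
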